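{- Let $k\ge2$. For every $M\in\{1,2,\dots\}\cup\{\infty\}$ and $N\in\{0,1,2,\dots\}$, the graph $SW_{k,N,M}$ is connected.
   Context: The oriented spider-web graph $\vec{SW}_{k,N,M}$ has vertex set $\{0,\dots,k-1\}^N\times\mathbb Z/M\mathbb Z$ (with $\mathbb Z/\infty\mathbb Z:=\mathbb Z$) and, for each vertex $(x_1\dots x_N,i)$ and each $y\in\{0,\dots,k-1\}$, one edge from $(x_1\dots x_N,i)$ to $(x_2\dots x_Ny,i+1)$; $SW_{k,N,M}$ is its underlying non-oriented graph. -}

module Defs where

open import Data.Nat using (ℕ; suc)
open import Data.Nat.DivMod using (_mod_)
open import Data.Fin using (Fin; toℕ)
open import Data.Integer using (ℤ)
import Data.Integer as ℤ
open import Data.Vec using (Vec; []; _∷_; _∷ʳ_)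
open import Data.Product using (_×_; _,_; ∃)
open import Data.Sum using (_⊎_)
open import Relation.Binary.PropositionalEquality using (_≡_)
open import Relation.Binary.Construct.Closure.ReflexiveTransitive using (Star)

-- M ∈ {1,2,...} ∪ {∞}: `fin m` encodes M = suc m (so M ≥ 1), `∞` encodes M = ∞.
data ℕ⁺∞ : Set where
  fin : ℕ → ℕ⁺∞
  ∞   : ℕ⁺∞

ZMod : ℕ⁺∞ → Set
ZMod (fin m) = Fin (suc m)
ZMod ∞       = ℤ

succMod : (M : ℕ⁺∞) → ZMod M → ZMod M
succMod (fin m) i = suc (toℕ i) mod (suc m)
succMod ∞ i = ℤ.suc i

shift : ∀ {A : Set} {N : ℕ} → Vec A N → A → Vec A N
shift []       y = []
shift (x ∷ xs) y = xs ∷ʳ y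

Vertex : (k N : ℕ) (M : ℕ⁺∞) → Set
Vertex k N M = Vec (Fin k) N × ZMod M

data OEdge (k N : ℕ) (M : ℕ⁺∞) : Vertex k N M → Vertex k N M → Set where
  edge : (x : Vec (Fin k) N) (i : ZMod M) (y : Fin k) →
         OEdge k N M (x , i) (shift x y , succMod M i)

Adj : (k N : ℕ) (M : ℕ⁺∞) → Vertex k N M → Vertex k N M → Set
Adj k N M u v = OEdge k N M u v ⊎ OEdge k N M v u

Connected : (k N : ℕ) (M : ℕ⁺∞) → Set
Connected k N M = ∀ (u v : Vertex k N M) → Star (Adj k N M) u v

-- Reading N letters w forward from any vertex (x, i) leads to (w, i + N), so all words
-- at a level are connected through a common endpoint; one more forward edge links level i
-- to level i + 1. Hence connectivity of SW reduces to that of the cycle Z/MZ (or the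
-- line Z) under i ↦ i + 1, which is clear.
module Submission where

open import Defs
open import Data.Nat using (ℕ; _≥_; _<_; _%_; zero; suc)
open import Data.Nat.Properties using (<-trans; n<1+n)
open import Data.Nat.DivMod using (m<n⇒m%n≡m)
open import Data.Nat.GeneralisedArithmetic using (iterate)
open import Data.Fin as Fin using (Fin; toℕ; fromℕ<)
open import Data.Fin.Properties using (toℕ-fromℕ<; fromℕ<-toℕ; toℕ-injective; toℕ<n)
open import Data.Integer using (ℤ; +_; -[1+_])
open import Data.Vec using (Vec; []; _∷_; _∷ʳ_; toList)
open import Data.Vec.Properties using (toList-∷ʳ; toList-injective)
open import Data.Vec.Relation.Binary.Equality.Cast using (cast-is-id)
open import Data.List as List using (List; drop; _++_; [_])
open import Data.List.Properties using (++-assoc; ++-identityʳ; drop-drop)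
open import Data.Product using (_,_)
open import Data.Sum using (inj₁; inj₂)
open import Relation.Binary.PropositionalEquality
  using (_≡_; refl; sym; trans; cong; subst; module ≡-Reasoning)
open import Relation.Binary.Construct.Closure.ReflexiveTransitive
  using (Star; ε; _◅_; _◅◅_; reverse)

shifts : ∀ {A : Set} {N n} → Vec A N → Vec A n → Vec A N
shifts x []       = x
shifts x (y ∷ ws) = shifts (shift x y) ws

module _ {A : Set} where

  drop-toList-++ : ∀ {N} (x : Vec A N) (l : List A) → drop N (toList x ++ l) ≡ l
  drop-toList-++ []       l = refl
  drop-toList-++ (_ ∷ xs) l = drop-toList-++ xs l

  toList-shift-++ : ∀ {N} (x : Vec A N) (y : A) (l : List A) →
                    toList (shift x y) ++ l ≡ drop 1 (toList x ++ y List.∷ l)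
  toList-shift-++ []       y l = refl
  toList-shift-++ (_ ∷ xs) y l = begin
    toList (xs ∷ʳ y) ++ l      ≡⟨ cong (_++ l) (toList-∷ʳ y xs) ⟩
    (toList xs ++ [ y ]) ++ l  ≡⟨ ++-assoc (toList xs) [ y ] l ⟩
    toList xs ++ y List.∷ l    ∎
    where open ≡-Reasoning

  toList-shifts : ∀ {N n} (x : Vec A N) (ws : Vec A n) →
                  toList (shifts x ws) ≡ drop n (toList x ++ toList ws)
  toList-shifts x [] = sym (++-identityʳ (toList x))
  toList-shifts x (_∷_ {n} y ws) = begin
    toList (shifts (shift x y) ws)                 ≡⟨ toList-shifts (shift x y) ws ⟩
    drop n (toList (shift x y) ++ toList ws)       ≡⟨ cong (drop n) (toList-shift-++ x y (toList ws)) ⟩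
    drop n (drop 1 (toList x ++ toList (y ∷ ws)))  ≡⟨ drop-drop 1 n (toList x ++ toList (y ∷ ws)) ⟩
    drop (suc n) (toList x ++ toList (y ∷ ws))     ∎
    where open ≡-Reasoning

  shifts-full : ∀ {N} (x w : Vec A N) → shifts x w ≡ w
  shifts-full x w = trans (sym (cast-is-id refl (shifts x w)))
    (toList-injective refl (shifts x w) w (trans (toList-shifts x w) (drop-toList-++ x (toList w))))

module _ {k N : ℕ} {M : ℕ⁺∞} where

  Path : Vertex k N M → Vertex k N M → Set
  Path = Star (Adj k N M)

  Path-sym : ∀ {u v} → Path u v → Path v u
  Path-sym = reverse λ { (inj₁ e) → inj₂ e ; (inj₂ e) → inj₁ e }

  forward-path : ∀ {n} (x : Vec (Fin k) N) (i : ZMod M) (ws : Vec (Fin k) n) →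
                 Path (x , i) (shifts x ws , iterate (succMod M) i n)
  forward-path x i []       = ε
  forward-path x i (y ∷ ws) = inj₁ (edge x i y) ◅ forward-path (shift x y) (succMod M i) ws

  path-to-word : ∀ (x w : Vec (Fin k) N) i → Path (x , i) (w , iterate (succMod M) i N)
  path-to-word x w i = subst (λ t → Path (x , i) (t , _)) (shifts-full x w) (forward-path x i w)

  LevelsConnected : ZMod M → ZMod M → Set
  LevelsConnected i j = ∀ x z → Path (x , i) (z , j)

  LevelsConnected-refl : ∀ i → LevelsConnected i i
  LevelsConnected-refl i x z = path-to-word x x i ◅◅ Path-sym (path-to-word z x i)

  LevelsConnected-sym : ∀ {i j} → LevelsConnected i j → LevelsConnected j i
  LevelsConnected-sym p x z = Path-sym (p z x)

  LevelsConnected-trans : ∀ {i j l} →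
                          LevelsConnected i j → LevelsConnected j l → LevelsConnected i l
  LevelsConnected-trans p q x z = p x x ◅◅ q x z

  LevelsConnected-succ : Fin k → ∀ i → LevelsConnected i (succMod M i)
  LevelsConnected-succ a i x z = inj₁ (edge x i a) ◅ LevelsConnected-refl (succMod M i) (shift x a) z

succMod-fromℕ< : ∀ {m n} .(n<1+m : n < suc m) (1+n<1+m : suc n < suc m) →
                 succMod (fin m) (fromℕ< n<1+m) ≡ fromℕ< 1+n<1+m
succMod-fromℕ< {m} {n} n<1+m 1+n<1+m = toℕ-injective (begin
  toℕ (succMod (fin m) (fromℕ< n<1+m))  ≡⟨ toℕ-fromℕ< _ ⟩
  suc (toℕ (fromℕ< n<1+m)) % suc m      ≡⟨ cong (λ t → suc t % suc m) (toℕ-fromℕ< n<1+m) ⟩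
  suc n % suc m                         ≡⟨ m<n⇒m%n≡m 1+n<1+m ⟩
  suc n                                 ≡⟨ sym (toℕ-fromℕ< 1+n<1+m) ⟩
  toℕ (fromℕ< 1+n<1+m)                  ∎)
  where open ≡-Reasoning

module _ {k N : ℕ} (a : Fin k) where

  LevelsConnected-fin : ∀ {m} (i j : Fin (suc m)) → LevelsConnected {k} {N} {fin m} i j
  LevelsConnected-fin {m} i j =
    LevelsConnected-trans (LevelsConnected-sym (from-zero i)) (from-zero j)
    where
    from-zero-ℕ : ∀ n (n<1+m : n < suc m) →
                  LevelsConnected {k} {N} {fin m} Fin.zero (fromℕ< n<1+m)
    from-zero-ℕ zero    _       = LevelsConnected-refl Fin.zero
    from-zero-ℕ (suc n) 1+n<1+m = subst (LevelsConnected Fin.zero) (succMod-fromℕ< n<1+m 1+n<1+m)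
      (LevelsConnected-trans (from-zero-ℕ n n<1+m) (LevelsConnected-succ a _))
      where n<1+m = <-trans (n<1+n n) 1+n<1+m

    from-zero : ∀ j → LevelsConnected Fin.zero j
    from-zero j = subst (LevelsConnected Fin.zero) (fromℕ<-toℕ j (toℕ<n j))
                        (from-zero-ℕ (toℕ j) (toℕ<n j))

  LevelsConnected-ℤ : (i j : ℤ) → LevelsConnected {k} {N} {∞} i j
  LevelsConnected-ℤ i j =
    LevelsConnected-trans (LevelsConnected-sym (from-zero i)) (from-zero j)
    where
    from-zero : ∀ j → LevelsConnected (+ 0) j
    from-zero (+ zero)     = LevelsConnected-refl (+ 0)
    from-zero (+ suc n)    = LevelsConnected-trans (from-zero (+ n)) (LevelsConnected-succ a (+ n))
    from-zero -[1+ zero ]  = LevelsConnected-sym (LevelsConnected-succ a -[1+ 0 ])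
    from-zero -[1+ suc n ] = LevelsConnected-trans (from-zero -[1+ n ])
                               (LevelsConnected-sym (LevelsConnected-succ a -[1+ suc n ]))

  connected : ∀ M → Connected k N M
  connected (fin m) (x , i) (z , j) = LevelsConnected-fin i j x z
  connected ∞       (x , i) (z , j) = LevelsConnected-ℤ i j x z

lemma4p8 : (k : ℕ) → k ≥ 2 → (M : ℕ⁺∞) (N : ℕ) → Connected k N M
lemma4p8 zero    ()
lemma4p8 (suc k) _ M N = connected {N = N} Fin.zero M
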